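{- For all $n \ge 1$, $$|S_n(132, 2341, 4213)| = F_{n+5} - \binom{n+1}{2} - 2 \binom{n+1}{1} - 2,$$ and $$\sum_{n=0}^\infty |S_n(132, 2341, 4213)|\, x^n = \frac{1 - 3x+3x^2+x^3-x^4}{(1 - x - x^2) (1 - x)^3}.$$
   Context: $S_n$ is the set of permutations of $\{1,\dots,n\}$ in one-line notation; $\pi$ avoids $\sigma\in S_k$ if no subsequence of $\pi$ of length $k$ has the same relative order as $\sigma$; $S_n(R)$ is the set of $\pi\in S_n$ avoiding every element of $R$, and $S_0(R)$ contains only the empty permutation. $F_n$ denotes the Fibonacci numbers, $F_0=0$, $F_1=1$, $F_n=F_{n-1}+F_{n-2}$. -}

module Defs where

open import Data.Nat using (ℕ; zero; suc; _+_; _*_)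
open import Data.Nat.Combinatorics using (_C_)
open import Data.Integer as ℤ using (ℤ; +_; -_)
open import Data.Fin as Fin using (Fin)
open import Data.Vec using (Vec; lookup; _∷_; [])
open import Data.List using (List; length)
open import Data.List.Relation.Unary.Unique.Propositional using (Unique)
open import Data.List.Membership.Propositional using (_∈_)
open import Data.Product using (Σ; ∃; _×_)
open import Relation.Nullary using (¬_)
open import Relation.Binary.PropositionalEquality using (_≡_)
open import Function.Bundles using (_⇔_)

F : ℕ → ℕ
F zero = 0
F (suc zero) = 1
F (suc (suc n)) = F (suc n) + F n

-- A permutation of {1,…,n} in one-line notation, written 0-based:
-- a vector of n entries in Fin n with pairwise distinct entries.
IsPerm : ∀ {n} → Vec (Fin n) n → Set
IsPerm {n} π = ∀ (i j : Fin n) → lookup π i ≡ lookup π j → i ≡ j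

Contains : ∀ {n k} → Vec (Fin n) n → Vec ℕ k → Set
Contains {n} {k} π σ =
  Σ (Fin k → Fin n) λ f →
    (∀ a b → a Fin.< b → f a Fin.< f b) ×
    (∀ a b → (lookup σ a Data.Nat.< lookup σ b) ⇔ (lookup π (f a) Fin.< lookup π (f b)))

Avoids : ∀ {n k} → Vec (Fin n) n → Vec ℕ k → Set
Avoids π σ = ¬ Contains π σ

p132 : Vec ℕ 3
p132 = 1 ∷ 3 ∷ 2 ∷ []

p2341 : Vec ℕ 4
p2341 = 2 ∷ 3 ∷ 4 ∷ 1 ∷ []

p4213 : Vec ℕ 4
p4213 = 4 ∷ 2 ∷ 1 ∷ 3 ∷ []

InS : ∀ n → Vec (Fin n) n → Set
InS n π = IsPerm π × Avoids π p132 × Avoids π p2341 × Avoids π p4213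

HasCard : ∀ n → (Vec (Fin n) n → Set) → ℕ → Set
HasCard n P k =
  Σ (List (Vec (Fin n) n)) λ L →
    Unique L × length L ≡ k × (∀ π → (π ∈ L) ⇔ P π)

-- Formal power series over ℤ as coefficient sequences; multiplication of a
-- series by a polynomial given by its coefficient list (constant term first).
shiftPS : (ℕ → ℤ) → ℕ → ℤ
shiftPS A zero = + 0
shiftPS A (suc m) = A m

mulPS : List ℤ → (ℕ → ℤ) → ℕ → ℤ
mulPS List.[] A m = + 0
mulPS (c List.∷ p) A m = c ℤ.* A m ℤ.+ mulPS p (shiftPS A) m

coeff : List ℤ → ℕ → ℤ
coeff List.[] m = + 0
coeff (c List.∷ p) zero = c
coeff (c List.∷ p) (suc m) = coeff p m

numer : List ℤ
numer = + 1 List.∷ - (+ 3) List.∷ + 3 List.∷ + 1 List.∷ - (+ 1) List.∷ List.[]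

fibDen : List ℤ
fibDen = + 1 List.∷ - (+ 1) List.∷ - (+ 1) List.∷ List.[]

oneMinusX : List ℤ
oneMinusX = + 1 List.∷ - (+ 1) List.∷ List.[]

denomTimes : (ℕ → ℤ) → ℕ → ℤ
denomTimes A = mulPS fibDen (mulPS oneMinusX (mulPS oneMinusX (mulPS oneMinusX A)))

{-# OPTIONS --safe #-}
-- Write π ∈ S_{n+1}(132, 2341, 4213) as α n β. Avoiding 132 puts every letter of α above
-- every letter of β. If β is empty then π = σ n with σ ∈ S_n(132, 2341, 4213). Otherwise avoiding
-- 2341 makes α decreasing, so α = (n−1)(n−2)⋯(n−c), and avoiding 4213 (with n as the 4) makes β
-- avoid 213, so β ∈ S_j(132, 213, 2341) with j ≥ 1. The same analysis shows that a nonempty member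
-- of S_j(132, 213, 2341) is the identity, or j−1 followed by a member of S_{j−1}, or (j−2)(j−1)
-- followed by a member of S_{j−2}; conversely all these words lie in the classes, because of how
-- the patterns split over a skew sum. Hence b_j = |S_j(132, 213, 2341)| satisfies b_j + 1 = F_{j+2}
-- and a_{n+1} = a_n + Σ_{j≤n} b_j, which gives the closed form; three differences turn a_n into
-- b_{n+2} − b_{n+1}, which 1 − x − x² annihilates, and this gives the generating function.

module Submission where

open import Data.Nat using (ℕ; zero; suc; _+_; _*_; _≤_; _<_; _≥_; _<?_; _≟_; z≤n; s≤s; z<s; s<s)
open import Data.Nat.Properties
import Data.Nat.Tactic.RingSolver as ℕ-Solver
open import Data.Nat.Combinatorics using (_C_; nC1≡n; nCk+nC[k+1]≡[n+1]C[k+1])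
open import Data.Nat.DivMod using (_mod_; m≤n⇒m%n≡m)
open import Data.Integer as ℤ using (ℤ; +_; -_; _-_)
import Data.Integer.Properties as ℤ
import Data.Integer.Tactic.RingSolver as ℤ-Solver
open import Data.Fin as Fin using (Fin; zero; suc; toℕ; #_)
open import Data.Fin.Properties using (toℕ<n; toℕ-fromℕ<; toℕ-injective) renaming (<-cmp to <-cmpᶠ)
open import Data.Vec as Vec using (Vec; []; _∷_)
open import Data.Vec.Properties using (length-toList)
open import Data.List as List using (List; []; _∷_; _++_; length; map; upTo; applyUpTo; applyDownFrom)
open import Data.List.Properties
  using (length-++; length-++-sucʳ; length-map; ++-assoc; ++-identityʳ; ++-cancelˡ; ++-cancelʳ;
         ∷-injectiveˡ; ∷-injectiveʳ; applyUpTo-∷ʳ; length-applyDownFrom; tabulate-cong; map-∘; map-id-local)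
open import Data.List.Membership.Propositional using (_∈_; _∉_)
open import Data.List.Membership.Propositional.Properties
  using (∈-∃++; ∈-++⁻; ∈-++⁺ˡ; ∈-++⁺ʳ; ∈-map⁻; ∈-map⁺; ∈-applyUpTo⁻; ∈-applyDownFrom⁻)
open import Data.List.Membership.DecPropositional _≟_ using (_∈?_)
open import Data.List.Relation.Unary.Any using (here; there)
open import Data.List.Relation.Unary.All as All using (All; []; _∷_)
import Data.List.Relation.Unary.All.Properties as Allₚ
open import Data.List.Relation.Unary.AllPairs using ([]; _∷_)
open import Data.List.Relation.Unary.Unique.Propositional using (Unique)
import Data.List.Relation.Unary.Unique.Propositional.Properties as Unique
open import Data.List.Relation.Binary.Disjoint.Propositional using (Disjoint)
open import Data.List.Relation.Binary.Sublist.Propositional {A = ℕ}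
  using (_⊆_; []; _∷_; _∷ʳ_; ⊆-refl; ⊆-trans; minimum; from∈; to∈)
open import Data.List.Relation.Binary.Sublist.Propositional.Properties
  using (++⁺; ++⁺ˡ; ++⁺ʳ; ∷ˡ⁻; All-resp-⊆; Any-resp-⊆; length-mono-≤)
open import Data.Product using (Σ; ∃₂; _×_; _,_; proj₁; proj₂)
open import Data.Sum using (_⊎_; inj₁; inj₂; [_,_]′)
open import Data.Empty using (⊥; ⊥-elim)
open import Function using (_∘_; case_of_; _⇔_; mk⇔; Equivalence)
open import Relation.Nullary using (¬_; yes; no)
open import Relation.Nullary.Decidable using (True; toWitness)
open import Relation.Binary using (tri<; tri≈; tri>)
open import Relation.Binary.PropositionalEquality
open ≡-Reasoning

open import Defs

Word : Set
Word = List ℕ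

Occurs : (Word → Set) → Word → Set
Occurs P w = Σ Word λ s → s ⊆ w × P s

Occurs-mono : ∀ {P w w′} → w ⊆ w′ → Occurs P w → Occurs P w′
Occurs-mono w⊆w′ (s , s⊆w , ps) = s , ⊆-trans s⊆w w⊆w′ , ps

⊆-++-split : ∀ α {β s} → s ⊆ α ++ β →
  ∃₂ λ s₁ s₂ → s ≡ s₁ ++ s₂ × s₁ ⊆ α × s₂ ⊆ β
⊆-++-split []      p = [] , _ , refl , [] , p
⊆-++-split (x ∷ α) (.x ∷ʳ p) with s₁ , s₂ , refl , p₁ , p₂ ← ⊆-++-split α p =
  s₁ , s₂ , refl , x ∷ʳ p₁ , p₂
⊆-++-split (x ∷ α) (refl ∷ p) with s₁ , s₂ , refl , p₁ , p₂ ← ⊆-++-split α p =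
  x ∷ s₁ , s₂ , refl , refl ∷ p₁ , p₂

⊆-drop-∷ : ∀ α {x β} → α ++ β ⊆ α ++ x ∷ β
⊆-drop-∷ α {x} = ++⁺ ⊆-refl (x ∷ʳ ⊆-refl)

-- Distinctness and monotonicity say that certain two-letter subwords do not occur, so they pass
-- to subwords.
Distinct : Word → Set
Distinct w = ∀ x → ¬ (x ∷ x ∷ [] ⊆ w)

Increasing : Word → Set
Increasing w = ∀ {x y} → x ∷ y ∷ [] ⊆ w → x < y

Decreasing : Word → Set
Decreasing w = ∀ {x y} → x ∷ y ∷ [] ⊆ w → y < x

Above : Word → Word → Set
Above α β = ∀ {a b} → a ∈ α → b ∈ β → b < a

record Perm (n : ℕ) (w : Word) : Set where
  constructor perm
  field
    distinct : Distinct w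
    bounded  : All (_< n) w
    length≡  : length w ≡ n

open Perm public

Distinct-⊆ : ∀ {v w} → v ⊆ w → Distinct w → Distinct v
Distinct-⊆ v⊆w d x p = d x (⊆-trans p v⊆w)

Distinct-++⇒disjoint : ∀ α {β x} → Distinct (α ++ β) → x ∈ α → x ∈ β → ⊥
Distinct-++⇒disjoint α d x∈α x∈β = d _ (++⁺ (from∈ x∈α) (from∈ x∈β))

Distinct-insert⁻ : ∀ α {x β} → Distinct (α ++ x ∷ β) → x ∉ α ++ β
Distinct-insert⁻ α d x∈αβ with ∈-++⁻ α x∈αβ
... | inj₁ x∈α = Distinct-++⇒disjoint α d x∈α (here refl)
... | inj₂ x∈β = d _ (++⁺ˡ α (refl ∷ from∈ x∈β))

Distinct-insert : ∀ α {x β} → x ∉ α ++ β → Distinct (α ++ β) → Distinct (α ++ x ∷ β)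
Distinct-insert []      x∉ d y (_ ∷ʳ p)   = d y p
Distinct-insert []      x∉ d y (refl ∷ p) = x∉ (to∈ p)
Distinct-insert (a ∷ α) x∉ d y (_ ∷ʳ p)   =
  Distinct-insert α (x∉ ∘ there) (Distinct-⊆ (a ∷ʳ ⊆-refl) d) y p
Distinct-insert (a ∷ α) x∉ d y (refl ∷ p) with ∈-++⁻ α (to∈ p)
... | inj₁ a∈α        = d a (refl ∷ from∈ (∈-++⁺ˡ a∈α))
... | inj₂ (here refl) = x∉ (here refl)
... | inj₂ (there a∈β) = d a (refl ∷ from∈ (∈-++⁺ʳ α a∈β))

bounded-∉ : ∀ {b w} → All (_< suc b) w → b ∉ w → All (_< b) w
bounded-∉ bnd b∉w =
  All.tabulate λ x∈w → ≤∧≢⇒< (≤-pred (All.lookup bnd x∈w)) λ { refl → b∉w x∈w }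

Perm⇒∉ : ∀ {n w} → Perm n w → n ∉ w
Perm⇒∉ p n∈w = <-irrefl refl (All.lookup (bounded p) n∈w)

remove-max : ∀ α {n β} → Perm (suc n) (α ++ n ∷ β) → Perm n (α ++ β)
remove-max α {n} {β} (perm d bnd len) = perm
  (Distinct-⊆ (⊆-drop-∷ α) d)
  (bounded-∉ (All-resp-⊆ (⊆-drop-∷ α) bnd) (Distinct-insert⁻ α d))
  (suc-injective (trans (sym (length-++-sucʳ α n β)) len))

below-max : ∀ α {n β} → Perm (suc n) (α ++ n ∷ β) → All (_< n) (α ++ β)
below-max α p = bounded (remove-max α p)

insert-max : ∀ α {n β} → Perm n (α ++ β) → Perm (suc n) (α ++ n ∷ β)
insert-max α {n} {β} p@(perm d bnd len) = perm
  (Distinct-insert α (Perm⇒∉ p) d)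
  (Allₚ.++⁺ (All.map m<n⇒m<1+n (Allₚ.++⁻ˡ α bnd))
            (n<1+n n ∷ All.map m<n⇒m<1+n (Allₚ.++⁻ʳ α bnd)))
  (trans (length-++-sucʳ α n β) (cong suc len))

distinct-bounded⇒length≤ : ∀ b {w} → Distinct w → All (_< b) w → length w ≤ b
distinct-bounded⇒length≤ zero    {[]}    d bnd       = z≤n
distinct-bounded⇒length≤ zero    {_ ∷ _} d (() ∷ _)
distinct-bounded⇒length≤ (suc b) {w}     d bnd with b ∈? w
... | no  b∉w = m≤n⇒m≤1+n (distinct-bounded⇒length≤ b d (bounded-∉ bnd b∉w))
... | yes b∈w with α , β , refl ← ∈-∃++ b∈w =
  subst (_≤ suc b) (sym (length-++-sucʳ α b β))
    (s≤s (distinct-bounded⇒length≤ b (Distinct-⊆ (⊆-drop-∷ α) d)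
                                     (bounded-∉ (All-resp-⊆ (⊆-drop-∷ α) bnd) (Distinct-insert⁻ α d))))

max-∈ : ∀ {n w} → Perm (suc n) w → n ∈ w
max-∈ {n} {w} (perm d bnd len) with n ∈? w
... | yes n∈w = n∈w
... | no  n∉w = ⊥-elim (<-irrefl len (s≤s (distinct-bounded⇒length≤ n d (bounded-∉ bnd n∉w))))

-- Patterns and skew sums

data Pattern₃ (R : ℕ → ℕ → ℕ → Set) : Word → Set where
  ⟨_⟩ : ∀ {a b c} → R a b c → Pattern₃ R (a ∷ b ∷ c ∷ [])

data Pattern₄ (R : ℕ → ℕ → ℕ → ℕ → Set) : Word → Set where
  ⟨_⟩ : ∀ {a b c d} → R a b c d → Pattern₄ R (a ∷ b ∷ c ∷ d ∷ [])

Is123 Is132 Is213 : Word → Set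
Is123 = Pattern₃ λ a b c → a < b × b < c
Is132 = Pattern₃ λ a b c → a < c × c < b
Is213 = Pattern₃ λ a b c → b < a × a < c

Is2341 Is4213 : Word → Set
Is2341 = Pattern₄ λ a b c d → d < a × a < b × b < c
Is4213 = Pattern₄ λ a b c d → c < b × b < d × d < a

data Split₃ (R : ℕ → ℕ → ℕ → Set) : Word → Word → Set where
  0+3 : ∀ {a b c} → R a b c → Split₃ R [] (a ∷ b ∷ c ∷ [])
  1+2 : ∀ {a b c} → R a b c → Split₃ R (a ∷ []) (b ∷ c ∷ [])
  2+1 : ∀ {a b c} → R a b c → Split₃ R (a ∷ b ∷ []) (c ∷ [])
  3+0 : ∀ {a b c} → R a b c → Split₃ R (a ∷ b ∷ c ∷ []) []

data Split₄ (R : ℕ → ℕ → ℕ → ℕ → Set) : Word → Word → Set where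
  0+4 : ∀ {a b c d} → R a b c d → Split₄ R [] (a ∷ b ∷ c ∷ d ∷ [])
  1+3 : ∀ {a b c d} → R a b c d → Split₄ R (a ∷ []) (b ∷ c ∷ d ∷ [])
  2+2 : ∀ {a b c d} → R a b c d → Split₄ R (a ∷ b ∷ []) (c ∷ d ∷ [])
  3+1 : ∀ {a b c d} → R a b c d → Split₄ R (a ∷ b ∷ c ∷ []) (d ∷ [])
  4+0 : ∀ {a b c d} → R a b c d → Split₄ R (a ∷ b ∷ c ∷ d ∷ []) []

split₃ : ∀ {R} s₁ {s₂} → Pattern₃ R (s₁ ++ s₂) → Split₃ R s₁ s₂
split₃ []                  ⟨ r ⟩ = 0+3 r
split₃ (_ ∷ [])            ⟨ r ⟩ = 1+2 r
split₃ (_ ∷ _ ∷ [])        ⟨ r ⟩ = 2+1 r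
split₃ (_ ∷ _ ∷ _ ∷ [])    ⟨ r ⟩ = 3+0 r
split₃ (_ ∷ _ ∷ _ ∷ _ ∷ _) ()

split₄ : ∀ {R} s₁ {s₂} → Pattern₄ R (s₁ ++ s₂) → Split₄ R s₁ s₂
split₄ []                      ⟨ r ⟩ = 0+4 r
split₄ (_ ∷ [])                ⟨ r ⟩ = 1+3 r
split₄ (_ ∷ _ ∷ [])            ⟨ r ⟩ = 2+2 r
split₄ (_ ∷ _ ∷ _ ∷ [])        ⟨ r ⟩ = 3+1 r
split₄ (_ ∷ _ ∷ _ ∷ _ ∷ [])    ⟨ r ⟩ = 4+0 r
split₄ (_ ∷ _ ∷ _ ∷ _ ∷ _ ∷ _) ()

Above-⊆ : ∀ {α β s₁ s₂} → s₁ ⊆ α → s₂ ⊆ β → Above α β → Above s₁ s₂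
Above-⊆ p₁ p₂ ab a∈s₁ b∈s₂ = ab (Any-resp-⊆ p₁ a∈s₁) (Any-resp-⊆ p₂ b∈s₂)

occurs₃-++ : ∀ {R} α {β} → Occurs (Pattern₃ R) (α ++ β) →
  ∃₂ λ s₁ s₂ → s₁ ⊆ α × s₂ ⊆ β × Split₃ R s₁ s₂
occurs₃-++ α (s , p , r) with s₁ , s₂ , refl , p₁ , p₂ ← ⊆-++-split α p =
  s₁ , s₂ , p₁ , p₂ , split₃ s₁ r

occurs₄-++ : ∀ {R} α {β} → Occurs (Pattern₄ R) (α ++ β) →
  ∃₂ λ s₁ s₂ → s₁ ⊆ α × s₂ ⊆ β × Split₄ R s₁ s₂
occurs₄-++ α (s , p , r) with s₁ , s₂ , refl , p₁ , p₂ ← ⊆-++-split α p =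
  s₁ , s₂ , p₁ , p₂ , split₄ s₁ r

skew-132 : ∀ α {β} → Above α β → Occurs Is132 (α ++ β) → Occurs Is132 α ⊎ Occurs Is132 β
skew-132 α ab occ with occurs₃-++ α occ
... | _ , _ , _  , p₂ , 0+3 r         = inj₂ (_ , p₂ , ⟨ r ⟩)
... | _ , _ , p₁ , p₂ , 1+2 (a<c , _) =
  ⊥-elim (<-asym a<c (Above-⊆ p₁ p₂ ab (here refl) (there (here refl))))
... | _ , _ , p₁ , p₂ , 2+1 (a<c , _) =
  ⊥-elim (<-asym a<c (Above-⊆ p₁ p₂ ab (here refl) (here refl)))
... | _ , _ , p₁ , _  , 3+0 r         = inj₁ (_ , p₁ , ⟨ r ⟩)

skew-213 : ∀ α {β} → Above α β → Occurs Is213 (α ++ β) → Occurs Is213 α ⊎ Occurs Is213 β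
skew-213 α ab occ with occurs₃-++ α occ
... | _ , _ , _  , p₂ , 0+3 r         = inj₂ (_ , p₂ , ⟨ r ⟩)
... | _ , _ , p₁ , p₂ , 1+2 (_ , a<c) =
  ⊥-elim (<-asym a<c (Above-⊆ p₁ p₂ ab (here refl) (there (here refl))))
... | _ , _ , p₁ , p₂ , 2+1 (_ , a<c) =
  ⊥-elim (<-asym a<c (Above-⊆ p₁ p₂ ab (here refl) (here refl)))
... | _ , _ , p₁ , _  , 3+0 r         = inj₁ (_ , p₁ , ⟨ r ⟩)

skew-2341 : ∀ α {β} → Above α β → Occurs Is2341 (α ++ β) → Occurs Is123 α ⊎ Occurs Is2341 β
skew-2341 α ab occ with occurs₄-++ α occ
... | _ , _ , _  , p₂ , 0+4 r               = inj₂ (_ , p₂ , ⟨ r ⟩)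
... | _ , _ , p₁ , p₂ , 1+3 (_ , a<b , _) =
  ⊥-elim (<-asym a<b (Above-⊆ p₁ p₂ ab (here refl) (here refl)))
... | _ , _ , p₁ , p₂ , 2+2 (_ , _ , b<c) =
  ⊥-elim (<-asym b<c (Above-⊆ p₁ p₂ ab (there (here refl)) (here refl)))
... | _ , _ , p₁ , _  , 3+1 (_ , a<b , b<c) = inj₁ (_ , p₁ , ⟨ a<b , b<c ⟩)
... | _ , _ , p₁ , _  , 4+0 (_ , a<b , b<c) =
  inj₁ (_ , ⊆-trans (refl ∷ refl ∷ refl ∷ _ ∷ʳ []) p₁ , ⟨ a<b , b<c ⟩)

skew-4213 : ∀ α {β} → Above α β → Occurs Is4213 (α ++ β) → Occurs Is4213 α ⊎ Occurs Is213 β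
skew-4213 α ab occ with occurs₄-++ α occ
... | _ , _ , _  , p₂ , 0+4 (c<b , b<d , _) = inj₂ (_ , ⊆-trans (_ ∷ʳ ⊆-refl) p₂ , ⟨ c<b , b<d ⟩)
... | _ , _ , _  , p₂ , 1+3 (c<b , b<d , _) = inj₂ (_ , p₂ , ⟨ c<b , b<d ⟩)
... | _ , _ , p₁ , p₂ , 2+2 (_ , b<d , _) =
  ⊥-elim (<-asym b<d (Above-⊆ p₁ p₂ ab (there (here refl)) (there (here refl))))
... | _ , _ , p₁ , p₂ , 3+1 (_ , b<d , _) =
  ⊥-elim (<-asym b<d (Above-⊆ p₁ p₂ ab (there (here refl)) (here refl)))
... | _ , _ , p₁ , _  , 4+0 r               = inj₁ (_ , p₁ , ⟨ r ⟩)

append-max₃ : ∀ {R} σ {M} → (∀ {a b c} → R a b c → c < b) →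
  All (_< M) σ → Occurs (Pattern₃ R) (σ ++ M ∷ []) → Occurs (Pattern₃ R) σ
append-max₃ σ lastBelow bnd occ with occurs₃-++ σ occ
... | _ , _ , _  , _ ∷ʳ () , 0+3 _
... | _ , _ , _  , _ ∷ () , 0+3 _
... | _ , _ , _  , _ ∷ʳ () , 1+2 _
... | _ , _ , _  , _ ∷ () , 1+2 _
... | _ , _ , p₁ , refl ∷ [] , 2+1 r =
  ⊥-elim (<-asym (lastBelow r) (All.lookup bnd (Any-resp-⊆ p₁ (there (here refl)))))
... | _ , _ , _  , _ ∷ʳ () , 2+1 _
... | _ , _ , p₁ , _ , 3+0 r = _ , p₁ , ⟨ r ⟩

append-max₄ : ∀ {R} σ {M} → (∀ {a b c d} → R a b c d → d < a) →
  All (_< M) σ → Occurs (Pattern₄ R) (σ ++ M ∷ []) → Occurs (Pattern₄ R) σ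
append-max₄ σ lastBelow bnd occ with occurs₄-++ σ occ
... | _ , _ , _  , _ ∷ʳ () , 0+4 _
... | _ , _ , _  , _ ∷ () , 0+4 _
... | _ , _ , _  , _ ∷ʳ () , 1+3 _
... | _ , _ , _  , _ ∷ () , 1+3 _
... | _ , _ , _  , _ ∷ʳ () , 2+2 _
... | _ , _ , _  , _ ∷ () , 2+2 _
... | _ , _ , p₁ , refl ∷ [] , 3+1 r =
  ⊥-elim (<-asym (lastBelow r) (All.lookup bnd (Any-resp-⊆ p₁ (here refl))))
... | _ , _ , _  , _ ∷ʳ () , 3+1 _
... | _ , _ , p₁ , _ , 4+0 r = _ , p₁ , ⟨ r ⟩

Ascent Descent : Word → Set
Ascent  s = ∃₂ λ x y → x ∷ y ∷ [] ⊆ s × x < y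
Descent s = ∃₂ λ x y → x ∷ y ∷ [] ⊆ s × y < x

decreasing-avoids : ∀ {P w} → (∀ {s} → P s → Ascent s) → Decreasing w → ¬ Occurs P w
decreasing-avoids ascent dec (s , s⊆w , ps) with ascent ps
... | _ , _ , p , x<y = <-asym x<y (dec (⊆-trans p s⊆w))

increasing-avoids : ∀ {P w} → (∀ {s} → P s → Descent s) → Increasing w → ¬ Occurs P w
increasing-avoids descent inc (s , s⊆w , ps) with descent ps
... | _ , _ , p , y<x = <-asym y<x (inc (⊆-trans p s⊆w))

123-ascent : ∀ {s} → Is123 s → Ascent s
123-ascent ⟨ a<b , _ ⟩ = _ , _ , refl ∷ refl ∷ _ ∷ʳ [] , a<b

132-ascent : ∀ {s} → Is132 s → Ascent s
132-ascent ⟨ a<c , _ ⟩ = _ , _ , refl ∷ _ ∷ʳ refl ∷ [] , a<c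

4213-ascent : ∀ {s} → Is4213 s → Ascent s
4213-ascent ⟨ _ , b<d , _ ⟩ = _ , _ , _ ∷ʳ refl ∷ _ ∷ʳ refl ∷ [] , b<d

132-descent : ∀ {s} → Is132 s → Descent s
132-descent ⟨ _ , c<b ⟩ = _ , _ , _ ∷ʳ refl ∷ refl ∷ [] , c<b

213-descent : ∀ {s} → Is213 s → Descent s
213-descent ⟨ b<a , _ ⟩ = _ , _ , refl ∷ refl ∷ _ ∷ʳ [] , b<a

2341-descent : ∀ {s} → Is2341 s → Descent s
2341-descent ⟨ d<a , _ ⟩ = _ , _ , refl ∷ _ ∷ʳ _ ∷ʳ refl ∷ [] , d<a

short-avoids₃ : ∀ {R w} → length w ≤ 2 → ¬ Occurs (Pattern₃ R) w
short-avoids₃ |w|≤2 (_ , p , ⟨ _ ⟩) = ≤⇒≯ |w|≤2 (length-mono-≤ p)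

decreasing-∷ʳ-avoids-123 : ∀ σ {M} → Decreasing σ → ¬ Occurs Is123 (σ ++ M ∷ [])
decreasing-∷ʳ-avoids-123 σ dec occ with occurs₃-++ σ occ
... | _ , _ , _  , _ ∷ʳ () , 0+3 _
... | _ , _ , _  , _ ∷ () , 0+3 _
... | _ , _ , _  , _ ∷ʳ () , 1+2 _
... | _ , _ , _  , _ ∷ () , 1+2 _
... | _ , _ , p₁ , _ , 2+1 (a<b , _) = <-asym a<b (dec p₁)
... | _ , _ , p₁ , _ , 3+0 r = decreasing-avoids 123-ascent dec (_ , p₁ , ⟨ r ⟩)

Avoids₁ Avoids₂ : Word → Set
Avoids₁ w = ¬ Occurs Is132 w × ¬ Occurs Is2341 w × ¬ Occurs Is4213 w
Avoids₂ w = ¬ Occurs Is132 w × ¬ Occurs Is213 w × ¬ Occurs Is2341 w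

Avoids₁-⊆ : ∀ {v w} → v ⊆ w → Avoids₁ w → Avoids₁ v
Avoids₁-⊆ v⊆w (¬132 , ¬2341 , ¬4213) =
  ¬132 ∘ Occurs-mono v⊆w , ¬2341 ∘ Occurs-mono v⊆w , ¬4213 ∘ Occurs-mono v⊆w

Avoids₂-⊆ : ∀ {v w} → v ⊆ w → Avoids₂ w → Avoids₂ v
Avoids₂-⊆ v⊆w (¬132 , ¬213 , ¬2341) =
  ¬132 ∘ Occurs-mono v⊆w , ¬213 ∘ Occurs-mono v⊆w , ¬2341 ∘ Occurs-mono v⊆w

increasing-Avoids₂ : ∀ {w} → Increasing w → Avoids₂ w
increasing-Avoids₂ inc =
  increasing-avoids 132-descent inc , increasing-avoids 213-descent inc , increasing-avoids 2341-descent inc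

skew-Avoids₂ : ∀ α {β} → Above α β →
  ¬ Occurs Is132 α × ¬ Occurs Is213 α × ¬ Occurs Is123 α → Avoids₂ β → Avoids₂ (α ++ β)
skew-Avoids₂ α ab (¬132ᵅ , ¬213ᵅ , ¬123ᵅ) (¬132 , ¬213 , ¬2341) =
  [ ¬132ᵅ , ¬132 ]′ ∘ skew-132 α ab ,
  [ ¬213ᵅ , ¬213 ]′ ∘ skew-213 α ab ,
  [ ¬123ᵅ , ¬2341 ]′ ∘ skew-2341 α ab

short-skew-Avoids₂ : ∀ α {β} → length α ≤ 2 → Above α β → Avoids₂ β → Avoids₂ (α ++ β)
short-skew-Avoids₂ α short ab =
  skew-Avoids₂ α ab (short-avoids₃ short , short-avoids₃ short , short-avoids₃ short)

skew-Avoids₁ : ∀ α {β} → Above α β →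
  ¬ Occurs Is132 α × ¬ Occurs Is123 α × ¬ Occurs Is4213 α → Avoids₂ β → Avoids₁ (α ++ β)
skew-Avoids₁ α ab (¬132ᵅ , ¬123ᵅ , ¬4213ᵅ) (¬132 , ¬213 , ¬2341) =
  [ ¬132ᵅ , ¬132 ]′ ∘ skew-132 α ab ,
  [ ¬123ᵅ , ¬2341 ]′ ∘ skew-2341 α ab ,
  [ ¬4213ᵅ , ¬213 ]′ ∘ skew-4213 α ab

Avoids₁-∷ʳ-max : ∀ σ {M} → All (_< M) σ → Avoids₁ σ → Avoids₁ (σ ++ M ∷ [])
Avoids₁-∷ʳ-max σ bnd (¬132 , ¬2341 , ¬4213) =
  (λ o → ¬132  (append-max₃ σ proj₂ bnd o)) ,
  (λ o → ¬2341 (append-max₄ σ proj₁ bnd o)) ,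
  (λ o → ¬4213 (append-max₄ σ (λ r → proj₂ (proj₂ r)) bnd o))

applyUpTo-increasing : ∀ {f} → (∀ {i j} → i < j → f i < f j) → ∀ n → Increasing (applyUpTo f n)
applyUpTo-increasing f-mono (suc n) (_ ∷ʳ p) = applyUpTo-increasing (λ i<j → f-mono (s<s i<j)) n p
applyUpTo-increasing f-mono (suc n) (refl ∷ p) with ∈-applyUpTo⁻ _ (to∈ p)
... | i , _ , refl = f-mono z<s

applyDownFrom-decreasing : ∀ {f} → (∀ {i j} → i < j → f i < f j) →
  ∀ n → Decreasing (applyDownFrom f n)
applyDownFrom-decreasing f-mono (suc n) (_ ∷ʳ p) = applyDownFrom-decreasing f-mono n p
applyDownFrom-decreasing f-mono (suc n) (refl ∷ p) with ∈-applyDownFrom⁻ _ (to∈ p)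
... | i , i<n , refl = f-mono i<n

upTo-increasing : ∀ n → Increasing (upTo n)
upTo-increasing = applyUpTo-increasing (λ i<j → i<j)

upTo-perm : ∀ n → Perm n (upTo n)
upTo-perm zero    = perm (λ _ ()) [] refl
upTo-perm (suc n) = subst (Perm (suc n)) (applyUpTo-∷ʳ (λ i → i) n)
  (insert-max (upTo n) (subst (Perm n) (sym (++-identityʳ (upTo n))) (upTo-perm n)))

increasing-perm⇒upTo : ∀ n {w} → Increasing w → Perm n w → w ≡ upTo n
increasing-perm⇒upTo zero    {[]}    _ _ = refl
increasing-perm⇒upTo zero    {_ ∷ _} _ p with () ← length≡ p
increasing-perm⇒upTo (suc n) inc p with ∈-∃++ (max-∈ p)
... | α , [] , refl = trans (cong (_++ n ∷ []) α≡) (applyUpTo-∷ʳ (λ i → i) n)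
  where α≡ = increasing-perm⇒upTo n (λ xy → inc (++⁺ʳ _ xy))
               (subst (Perm n) (++-identityʳ α) (remove-max α p))
... | α , g ∷ γ , refl = ⊥-elim (≤⇒≯ g≤n (inc (++⁺ˡ α (refl ∷ refl ∷ minimum γ))))
  where g≤n = ≤-pred (All.lookup (bounded p) (∈-++⁺ʳ α (there (here refl))))

down : ℕ → ℕ → Word
down lo c = applyDownFrom (λ i → lo + i) c

down-decreasing : ∀ lo c → Decreasing (down lo c)
down-decreasing lo = applyDownFrom-decreasing (+-monoʳ-< lo)

∈-down⁻ : ∀ {lo c x} → x ∈ down lo c → lo ≤ x × x < lo + c
∈-down⁻ {lo} x∈ with ∈-applyDownFrom⁻ (λ i → lo + i) x∈
... | i , i<c , refl = m≤m+n lo i , +-monoʳ-< lo i<c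

down-perm : ∀ j c {β} → Perm j β → Perm (j + c) (down j c ++ β)
down-perm j zero    {β} p = subst (λ n → Perm n β) (sym (+-identityʳ j)) p
down-perm j (suc c) {β} p =
  subst (λ n → Perm n (down j (suc c) ++ β)) (sym (+-suc j c)) (insert-max [] (down-perm j c p))

head-above⇒max : ∀ {n a w} → Perm (suc n) (a ∷ w) → (∀ {b} → b ∈ w → b < a) → a ≡ n
head-above⇒max p above with max-∈ p
... | here n≡a  = sym n≡a
... | there n∈w = ⊥-elim (≤⇒≯ (≤-pred (All.head (bounded p))) (above n∈w))

head-above-rest : ∀ {a} α {β} → Decreasing (a ∷ α) → Above (a ∷ α) β →
  ∀ {b} → b ∈ α ++ β → b < a
head-above-rest α dec above b∈ =
  [ (λ b∈α → dec (refl ∷ from∈ b∈α)) , above (here refl) ]′ (∈-++⁻ α b∈)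

decreasing-skew-perm : ∀ α {n β} → Decreasing α → Above α β → Perm n (α ++ β) →
  α ≡ down (length β) (length α) × Perm (length β) β
decreasing-skew-perm []      {n} {β} _ _ p = refl , subst (λ k → Perm k β) (sym (length≡ p)) p
decreasing-skew-perm (a ∷ α) {zero}  _ _ p with () ← length≡ p
decreasing-skew-perm (a ∷ α) {suc n} {β} dec above p
  with refl ← head-above⇒max p (head-above-rest α dec above)
  with α≡ , pβ ← decreasing-skew-perm α (λ xy → dec (a ∷ʳ xy)) (λ x∈ → above (there x∈)) (remove-max [] p)
  = cong₂ _∷_ top≡ α≡ , pβ
  where
  top≡ : a ≡ length β + length α
  top≡ = trans (sym (length≡ (remove-max [] p))) (trans (length-++ α) (+-comm (length α) (length β)))

-- Decomposition at the maximum

132-avoiding⇒above : ∀ α {n γ} → Perm (suc n) (α ++ n ∷ γ) →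
  ¬ Occurs Is132 (α ++ n ∷ γ) → Above α γ
132-avoiding⇒above α {n} p ¬132 {a} {c} a∈α c∈γ with <-cmp a c
... | tri< a<c _ _ = ⊥-elim (¬132 (_ , ++⁺ (from∈ a∈α) (refl ∷ from∈ c∈γ) , ⟨ a<c , c<n ⟩))
  where c<n = All.lookup (below-max α p) (∈-++⁺ʳ α c∈γ)
... | tri≈ _ refl _ = ⊥-elim (Distinct-++⇒disjoint α (distinct p) a∈α (there c∈γ))
... | tri> _ _ c<a = c<a

2341-avoiding⇒decreasing : ∀ α {n g γ} → Perm (suc n) (α ++ n ∷ g ∷ γ) →
  ¬ Occurs Is2341 (α ++ n ∷ g ∷ γ) → Above α (g ∷ γ) → Decreasing α
2341-avoiding⇒decreasing α {n} {g} {γ} p ¬2341 above {x} {y} xy⊆α with <-cmp x y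
... | tri< x<y _ _ = ⊥-elim (¬2341 (_ , ++⁺ xy⊆α (refl ∷ refl ∷ minimum γ) , ⟨ g<x , x<y , y<n ⟩))
  where
  g<x = above (to∈ xy⊆α) (here refl)
  y<n = All.lookup (below-max α p) (∈-++⁺ˡ (to∈ (∷ˡ⁻ xy⊆α)))
... | tri≈ _ refl _ = ⊥-elim (distinct p x (++⁺ʳ _ xy⊆α))
... | tri> _ _ y<x = y<x

213-avoiding⇒increasing : ∀ α {n γ} → Perm (suc n) (α ++ n ∷ γ) →
  ¬ Occurs Is213 (α ++ n ∷ γ) → Increasing α
213-avoiding⇒increasing α {n} {γ} p ¬213 {x} {y} xy⊆α with <-cmp x y
... | tri< x<y _ _ = x<y
... | tri≈ _ refl _ = ⊥-elim (distinct p x (++⁺ʳ _ xy⊆α))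
... | tri> _ _ y<x = ⊥-elim (¬213 (_ , ++⁺ xy⊆α (refl ∷ minimum γ) , ⟨ y<x , x<n ⟩))
  where x<n = All.lookup (below-max α p) (∈-++⁺ˡ (to∈ xy⊆α))

4213-avoiding⇒213-avoiding : ∀ α {n γ} → Perm (suc n) (α ++ n ∷ γ) →
  ¬ Occurs Is4213 (α ++ n ∷ γ) → ¬ Occurs Is213 γ
4213-avoiding⇒213-avoiding α p ¬4213 (_ , abc⊆γ , ⟨ b<a , a<c ⟩) =
  ¬4213 (_ , ++⁺ˡ α (refl ∷ abc⊆γ) , ⟨ b<a , a<c , c<n ⟩)
  where c<n = All.lookup (below-max α p) (∈-++⁺ʳ α (Any-resp-⊆ abc⊆γ (there (there (here refl)))))

-- The enumerations

-- enum₂ j lists S_j(132, 213, 2341) only for j ≥ 1: it supplies the nonempty part after the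
-- maximum, so enum₂ 0 is empty.
enum₂ : ℕ → List Word
enum₂ zero          = []
enum₂ (suc zero)    = upTo 1 ∷ []
enum₂ (suc (suc i)) =
  upTo (2 + i) ∷ map (suc i ∷_) (enum₂ (suc i)) ++ map (λ γ → i ∷ suc i ∷ γ) (enum₂ i)

peaked : ℕ → ℕ → List Word
peaked j c = map (λ β → down j c ++ j + c ∷ β) (enum₂ j)

-- peakedAll c j is the union of the lists peaked j′ c′ with j′ + c′ = j + c and j′ ≥ j.
peakedAll : ℕ → ℕ → List Word
peakedAll zero    j = peaked j zero
peakedAll (suc c) j = peaked j (suc c) ++ peakedAll c (suc j)

enum₁ : ℕ → List Word
enum₁ zero    = [] ∷ []
enum₁ (suc n) = map (_++ n ∷ []) (enum₁ n) ++ peakedAll n 0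

enum₂-sound : ∀ j {β} → β ∈ enum₂ j → Perm j β × Avoids₂ β
enum₂-sound (suc zero)    (here refl) = upTo-perm 1 , increasing-Avoids₂ (upTo-increasing 1)
enum₂-sound (suc (suc i)) (here refl) = upTo-perm (2 + i) , increasing-Avoids₂ (upTo-increasing (2 + i))
enum₂-sound (suc (suc i)) (there β∈) with ∈-++⁻ (map (suc i ∷_) (enum₂ (suc i))) β∈
... | inj₁ β∈₁ with γ , γ∈ , refl ← ∈-map⁻ _ β∈₁ with p , av ← enum₂-sound (suc i) γ∈ =
  insert-max [] p , short-skew-Avoids₂ (suc i ∷ []) (s≤s z≤n) above av
  where
  above : Above (suc i ∷ []) γ
  above (here refl) b∈γ = All.lookup (bounded p) b∈γ
... | inj₂ β∈₂ with γ , γ∈ , refl ← ∈-map⁻ _ β∈₂ with p , av ← enum₂-sound i γ∈ =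
  insert-max (i ∷ []) (insert-max [] p) , short-skew-Avoids₂ (i ∷ suc i ∷ []) ≤-refl above av
  where
  above : Above (i ∷ suc i ∷ []) γ
  above (here refl)         b∈γ = All.lookup (bounded p) b∈γ
  above (there (here refl)) b∈γ = m<n⇒m<1+n (All.lookup (bounded p) b∈γ)

max-last-sound : ∀ {n σ} → Perm n σ × Avoids₁ σ →
  Perm (suc n) (σ ++ n ∷ []) × Avoids₁ (σ ++ n ∷ [])
max-last-sound {n} {σ} (p , av) =
  insert-max σ (subst (Perm n) (sym (++-identityʳ σ)) p) , Avoids₁-∷ʳ-max σ (bounded p) av

peaked-sound : ∀ j c {β} → β ∈ enum₂ j →
  Perm (suc (j + c)) (down j c ++ j + c ∷ β) × Avoids₁ (down j c ++ j + c ∷ β)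
peaked-sound j c {β} β∈ with p , av ← enum₂-sound j β∈ =
  insert-max (down j c) (down-perm j c p) ,
  subst Avoids₁ (++-assoc (down j c) (j + c ∷ []) β)
    (skew-Avoids₁ (down j c ++ j + c ∷ []) above (¬132 , decreasing-∷ʳ-avoids-123 (down j c) dec , ¬4213) av)
  where
  dec = down-decreasing j c
  run<top : All (_< j + c) (down j c)
  run<top = All.tabulate λ x∈ → proj₂ (∈-down⁻ x∈)
  ¬132 = decreasing-avoids 132-ascent dec ∘ append-max₃ (down j c) proj₂ run<top
  ¬4213 = decreasing-avoids 4213-ascent dec ∘ append-max₄ (down j c) (λ r → proj₂ (proj₂ r)) run<top
  above : Above (down j c ++ j + c ∷ []) β
  above a∈ b∈β with ∈-++⁻ (down j c) a∈
  ... | inj₁ a∈run       = <-≤-trans (All.lookup (bounded p) b∈β) (proj₁ (∈-down⁻ a∈run))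
  ... | inj₂ (here refl) = <-≤-trans (All.lookup (bounded p) b∈β) (m≤m+n j c)

∈-peakedAll⁺ : ∀ d c j {w} → w ∈ peaked (j + d) c → w ∈ peakedAll (d + c) j
∈-peakedAll⁺ zero    zero    j {w} w∈ = subst (λ k → w ∈ peaked k 0) (+-identityʳ j) w∈
∈-peakedAll⁺ zero    (suc c) j {w} w∈ =
  ∈-++⁺ˡ (subst (λ k → w ∈ peaked k (suc c)) (+-identityʳ j) w∈)
∈-peakedAll⁺ (suc d) c       j {w} w∈ =
  ∈-++⁺ʳ (peaked j (suc (d + c)))
         (∈-peakedAll⁺ d c (suc j) (subst (λ k → w ∈ peaked k c) (+-suc j d) w∈))

∈-peakedAll⁻ : ∀ c j {w} → w ∈ peakedAll c j → ∃₂ λ d c′ → d + c′ ≡ c × w ∈ peaked (j + d) c′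
∈-peakedAll⁻ zero    j {w} w∈ = 0 , 0 , refl , subst (λ k → w ∈ peaked k 0) (sym (+-identityʳ j)) w∈
∈-peakedAll⁻ (suc c) j {w} w∈ with ∈-++⁻ (peaked j (suc c)) w∈
... | inj₁ w∈₁ = 0 , suc c , refl , subst (λ k → w ∈ peaked k (suc c)) (sym (+-identityʳ j)) w∈₁
... | inj₂ w∈₂ with d , c′ , refl , w∈′ ← ∈-peakedAll⁻ c (suc j) w∈₂ =
  suc d , c′ , refl , subst (λ k → w ∈ peaked k c′) (sym (+-suc j d)) w∈′

enum₁-sound : ∀ n {w} → w ∈ enum₁ n → Perm n w × Avoids₁ w
enum₁-sound zero    (here refl) =
  perm (λ _ ()) [] refl , (λ { (_ , [] , ()) }) , (λ { (_ , [] , ()) }) , (λ { (_ , [] , ()) })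
enum₁-sound (suc n) w∈ with ∈-++⁻ (map (_++ n ∷ []) (enum₁ n)) w∈
... | inj₁ w∈₁ with σ , σ∈ , refl ← ∈-map⁻ _ w∈₁ = max-last-sound (enum₁-sound n σ∈)
... | inj₂ w∈₂
  with d , c , refl , w∈′ ← ∈-peakedAll⁻ n 0 w∈₂
  with β , β∈ , refl ← ∈-map⁻ _ w∈′
  = peaked-sound d c β∈

data Avoids₂-View : ℕ → Word → Set where
  identity     : ∀ {i} → Avoids₂-View i (upTo (suc i))
  top-first    : ∀ {i γ} → Perm (suc i) γ → Avoids₂ γ → Avoids₂-View (suc i) (suc i ∷ γ)
  second-first : ∀ {i γ} → Perm (suc i) γ → Avoids₂ γ →
                 Avoids₂-View (suc (suc i)) (suc i ∷ suc (suc i) ∷ γ)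

avoids₂-view : ∀ i {β} → Perm (suc i) β → Avoids₂ β → Avoids₂-View i β
avoids₂-view i p (¬132 , ¬213 , ¬2341) with ∈-∃++ (max-∈ p)
avoids₂-view i p (_ , ¬213 , _) | α , [] , refl =
  subst (Avoids₂-View i) (trans (sym (applyUpTo-∷ʳ (λ k → k) i)) (cong (_++ i ∷ []) (sym α≡))) identity
  where α≡ = increasing-perm⇒upTo i (213-avoiding⇒increasing α p ¬213)
               (subst (Perm i) (++-identityʳ α) (remove-max α p))
avoids₂-view zero p _ | [] , g ∷ γ , refl with () ← length≡ p
avoids₂-view (suc i) p av | [] , g ∷ γ , refl = top-first (remove-max [] p) (Avoids₂-⊆ (_ ∷ʳ ⊆-refl) av)
avoids₂-view zero p _ | a ∷ [] , g ∷ γ , refl with () ← length≡ p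
avoids₂-view (suc zero) p _ | a ∷ [] , g ∷ γ , refl with () ← length≡ p
avoids₂-view (suc (suc i)) p av@(¬132 , _ , _) | a ∷ [] , g ∷ γ , refl
  with refl ← head-above⇒max (remove-max (a ∷ []) p) (132-avoiding⇒above (a ∷ []) p ¬132 (here refl)) =
  second-first (remove-max [] (remove-max (a ∷ []) p)) (Avoids₂-⊆ (_ ∷ʳ _ ∷ʳ ⊆-refl) av)
avoids₂-view i p (¬132 , ¬213 , ¬2341) | a ∷ b ∷ α , g ∷ γ , refl =
  ⊥-elim (<-asym (213-avoiding⇒increasing (a ∷ b ∷ α) p ¬213 ab⊆) (dec ab⊆))
  where
  ab⊆ = refl ∷ refl ∷ minimum α
  dec = 2341-avoiding⇒decreasing (a ∷ b ∷ α) p ¬2341 (132-avoiding⇒above (a ∷ b ∷ α) p ¬132)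

enum₂-complete : ∀ i {β} → Perm (suc i) β → Avoids₂ β → β ∈ enum₂ (suc i)
enum₂-complete i p av with avoids₂-view i p av
enum₂-complete zero          _ _ | identity           = here refl
enum₂-complete (suc i)       _ _ | identity           = here refl
enum₂-complete (suc i)       _ _ | top-first q av′    = there (∈-++⁺ˡ (∈-map⁺ _ (enum₂-complete i q av′)))
enum₂-complete (suc (suc i)) _ _ | second-first q av′ =
  there (∈-++⁺ʳ (map (suc (suc i) ∷_) (enum₂ (suc (suc i)))) (∈-map⁺ _ (enum₂-complete i q av′)))

data Avoids₁-View : ℕ → Word → Set where
  max-last : ∀ {n σ} → Perm n σ → Avoids₁ σ → Avoids₁-View n (σ ++ n ∷ [])
  peak     : ∀ {j c β} → Perm (suc j) β → Avoids₂ β →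
             Avoids₁-View (suc j + c) (down (suc j) c ++ suc j + c ∷ β)

peak-view : ∀ {n c g γ} → n ≡ suc (length γ) + c →
  Perm (suc (length γ)) (g ∷ γ) → Avoids₂ (g ∷ γ) → Avoids₁-View n (down (suc (length γ)) c ++ n ∷ g ∷ γ)
peak-view refl = peak

avoids₁-view : ∀ n {w} → Perm (suc n) w → Avoids₁ w → Avoids₁-View n w
avoids₁-view n p av with ∈-∃++ (max-∈ p)
... | α , [] , refl =
  max-last (subst (Perm n) (++-identityʳ α) (remove-max α p)) (Avoids₁-⊆ (++⁺ʳ _ ⊆-refl) av)
avoids₁-view n p av@(¬132 , ¬2341 , ¬4213) | α , g ∷ γ , refl =
  subst (λ α′ → Avoids₁-View n (α′ ++ n ∷ g ∷ γ)) (sym α≡)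
    (peak-view n≡ pγ (¬132 ∘ Occurs-mono γ⊆ , 4213-avoiding⇒213-avoiding α p ¬4213 ,
                      ¬2341 ∘ Occurs-mono γ⊆))
  where
  above = 132-avoiding⇒above α p ¬132
  rest = remove-max α p
  decomposition = decreasing-skew-perm α (2341-avoiding⇒decreasing α p ¬2341 above) above rest
  α≡ = proj₁ decomposition
  pγ = proj₂ decomposition
  γ⊆ : g ∷ γ ⊆ α ++ n ∷ g ∷ γ
  γ⊆ = ++⁺ˡ α (n ∷ʳ ⊆-refl)
  n≡ : n ≡ suc (length γ) + length α
  n≡ = trans (sym (length≡ rest)) (trans (length-++ α) (+-comm (length α) _))

enum₁-complete : ∀ n {w} → Perm n w → Avoids₁ w → w ∈ enum₁ n
enum₁-complete zero    {[]}    _ _ = here refl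
enum₁-complete zero    {_ ∷ _} p _ with () ← length≡ p
enum₁-complete (suc n) p av with avoids₁-view n p av
... | max-last q av′       = ∈-++⁺ˡ (∈-map⁺ (_++ n ∷ []) (enum₁-complete n q av′))
... | peak {j} {c} q av′ = ∈-++⁺ʳ _ (∈-peakedAll⁺ (suc j) c 0 (∈-map⁺ _ (enum₂-complete j q av′)))

++∷-injective : ∀ (α α′ : Word) {x β β′} → x ∉ α → x ∉ α′ →
  α ++ x ∷ β ≡ α′ ++ x ∷ β′ → α ≡ α′ × β ≡ β′
++∷-injective []      []        _   _    e = refl , ∷-injectiveʳ e
++∷-injective []      (_ ∷ _)   _   x∉α′ e with refl ← ∷-injectiveˡ e = ⊥-elim (x∉α′ (here refl))
++∷-injective (_ ∷ _) []        x∉α _    e with refl ← ∷-injectiveˡ e = ⊥-elim (x∉α (here refl))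
++∷-injective (y ∷ α) (_ ∷ α′) x∉α x∉α′ e
  with refl ← ∷-injectiveˡ e
  with refl , refl ← ++∷-injective α α′ (x∉α ∘ there) (x∉α′ ∘ there) (∷-injectiveʳ e) = refl , refl

enum₂-pos : ∀ {j β} → β ∈ enum₂ j → 0 < j
enum₂-pos {suc _} _ = z<s

enum₂-nonempty : ∀ {j β} → β ∈ enum₂ j → β ≢ []
enum₂-nonempty β∈ refl = <-irrefl (length≡ (proj₁ (enum₂-sound _ β∈))) (enum₂-pos β∈)

enum₂-unique : ∀ j → Unique (enum₂ j)
enum₂-unique zero          = []
enum₂-unique (suc zero)    = [] ∷ []
enum₂-unique (suc (suc i)) =
  All.tabulate upTo≢ ∷ Unique.++⁺ (Unique.map⁺ ∷-injectiveʳ (enum₂-unique (suc i)))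
                                  (Unique.map⁺ (λ e → ∷-injectiveʳ (∷-injectiveʳ e)) (enum₂-unique i))
                                  disjoint
  where
  upTo≢ : ∀ {β} → β ∈ map (suc i ∷_) (enum₂ (suc i)) ++ map (λ γ → i ∷ suc i ∷ γ) (enum₂ i) →
          upTo (2 + i) ≢ β
  upTo≢ β∈ with ∈-++⁻ (map (suc i ∷_) (enum₂ (suc i))) β∈
  ... | inj₁ β∈₁ with _ , _ , refl ← ∈-map⁻ _ β∈₁ = λ ()
  ... | inj₂ β∈₂ with _ , γ∈ , refl ← ∈-map⁻ _ β∈₂ = λ e → <-irrefl (∷-injectiveˡ e) (enum₂-pos γ∈)
  disjoint : Disjoint (map (suc i ∷_) (enum₂ (suc i))) (map (λ γ → i ∷ suc i ∷ γ) (enum₂ i))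
  disjoint (β∈₁ , β∈₂) with _ , _ , refl ← ∈-map⁻ _ β∈₁ | _ , _ , e ← ∈-map⁻ _ β∈₂ =
    <-irrefl (sym (∷-injectiveˡ e)) (n<1+n i)

top∉down : ∀ j c → j + c ∉ down j c
top∉down j c x∈ = <-irrefl refl (proj₂ (∈-down⁻ x∈))

peaked-unique : ∀ j c → Unique (peaked j c)
peaked-unique j c = Unique.map⁺ (λ e → ∷-injectiveʳ (++-cancelˡ (down j c) _ _ e)) (enum₂-unique j)

peaked-run-length : ∀ {j c j′ c′ w} → j + c ≡ j′ + c′ →
  w ∈ peaked j c → w ∈ peaked j′ c′ → c ≡ c′
peaked-run-length {j} {c} {j′} {c′} top≡ w∈ w∈′
  with _ , _ , refl ← ∈-map⁻ _ w∈ | β′ , _ , e ← ∈-map⁻ _ w∈′ = begin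
  c                          ≡⟨ length-applyDownFrom (λ i → j + i) c ⟨
  length (down j c)          ≡⟨ cong length (proj₁ (++∷-injective (down j c) _ (top∉down j c) top∉ e′)) ⟩
  length (down j′ c′)        ≡⟨ length-applyDownFrom (λ i → j′ + i) c′ ⟩
  c′                         ∎
  where
  top∉ = subst (_∉ down j′ c′) (sym top≡) (top∉down j′ c′)
  e′ = trans e (cong (λ t → down j′ c′ ++ t ∷ β′) (sym top≡))

peakedAll-unique : ∀ c j → Unique (peakedAll c j)
peakedAll-unique zero    j = peaked-unique j 0
peakedAll-unique (suc c) j = Unique.++⁺ (peaked-unique j (suc c)) (peakedAll-unique c (suc j)) disjoint
  where
  disjoint : Disjoint (peaked j (suc c)) (peakedAll c (suc j))
  disjoint (w∈₁ , w∈₂) with d , c′ , refl , w∈′ ← ∈-peakedAll⁻ c (suc j) w∈₂ =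
    <-irrefl (sym (peaked-run-length top≡ w∈₁ w∈′)) (s≤s (m≤n+m c′ d))
    where
    top≡ : j + suc (d + c′) ≡ suc j + d + c′
    top≡ = trans (+-suc j (d + c′)) (cong suc (sym (+-assoc j d c′)))

enum₁-unique : ∀ n → Unique (enum₁ n)
enum₁-unique zero    = [] ∷ []
enum₁-unique (suc n) =
  Unique.++⁺ (Unique.map⁺ (λ {σ} {σ′} → ++-cancelʳ (n ∷ []) σ σ′) (enum₁-unique n))
             (peakedAll-unique n 0) disjoint
  where
  disjoint : Disjoint (map (_++ n ∷ []) (enum₁ n)) (peakedAll n 0)
  disjoint (w∈₁ , w∈₂)
    with σ , σ∈ , refl ← ∈-map⁻ _ w∈₁
    with d , c , refl , w∈′ ← ∈-peakedAll⁻ n 0 w∈₂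
    with β , β∈ , e ← ∈-map⁻ _ w∈′
    = enum₂-nonempty β∈ (sym (proj₂ (++∷-injective σ (down d c) n∉σ (top∉down d c) e)))
    where n∉σ = Perm⇒∉ (proj₁ (enum₁-sound n σ∈))

-- Counting

length-enum₂-suc-suc : ∀ i →
  length (enum₂ (2 + i)) ≡ suc (length (enum₂ (1 + i)) + length (enum₂ i))
length-enum₂-suc-suc i = cong suc (begin
  length (map (suc i ∷_) (enum₂ (suc i)) ++ map (λ γ → i ∷ suc i ∷ γ) (enum₂ i))
    ≡⟨ length-++ (map (suc i ∷_) (enum₂ (suc i))) ⟩
  length (map (suc i ∷_) (enum₂ (suc i))) + length (map (λ γ → i ∷ suc i ∷ γ) (enum₂ i))
    ≡⟨ cong₂ _+_ (length-map _ (enum₂ (suc i))) (length-map _ (enum₂ i)) ⟩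
  length (enum₂ (suc i)) + length (enum₂ i) ∎)

length-peaked : ∀ j c → length (peaked j c) ≡ length (enum₂ j)
length-peaked j c = length-map _ (enum₂ j)

length-peakedAll-suc : ∀ c j →
  length (peakedAll (suc c) j) ≡ length (peakedAll c j) + length (enum₂ (j + suc c))
length-peakedAll-suc zero j = begin
  length (peaked j 1 ++ peaked (suc j) 0)
    ≡⟨ length-++ (peaked j 1) ⟩
  length (peaked j 1) + length (peaked (suc j) 0)
    ≡⟨ cong₂ _+_ (length-peaked j 1) (length-peaked (suc j) 0) ⟩
  length (enum₂ j) + length (enum₂ (suc j))
    ≡⟨ cong₂ _+_ (length-peaked j 0) (cong (length ∘ enum₂) (+-comm j 1)) ⟨
  length (peaked j 0) + length (enum₂ (j + 1)) ∎
length-peakedAll-suc (suc c) j = begin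
  length (peaked j (2 + c) ++ peakedAll (suc c) (suc j))
    ≡⟨ length-++ (peaked j (2 + c)) ⟩
  length (peaked j (2 + c)) + length (peakedAll (suc c) (suc j))
    ≡⟨ cong₂ _+_ (trans (length-peaked j (2 + c)) (sym (length-peaked j (suc c))))
                 (length-peakedAll-suc c (suc j)) ⟩
  length (peaked j (suc c)) + (length (peakedAll c (suc j)) + length (enum₂ (suc j + suc c)))
    ≡⟨ +-assoc (length (peaked j (suc c))) _ _ ⟨
  length (peaked j (suc c)) + length (peakedAll c (suc j)) + length (enum₂ (suc j + suc c))
    ≡⟨ cong₂ _+_ (length-++ (peaked j (suc c))) (cong (λ k → length (enum₂ k)) (+-suc j (suc c))) ⟨
  length (peakedAll (suc c) j) + length (enum₂ (j + suc (suc c))) ∎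

length-enum₁-suc : ∀ n → length (enum₁ (suc n)) ≡ length (enum₁ n) + length (peakedAll n 0)
length-enum₁-suc n = trans (length-++ (map (_++ n ∷ []) (enum₁ n)))
                           (cong (_+ length (peakedAll n 0)) (length-map _ (enum₁ n)))

enum₂-fib : ∀ j → suc (length (enum₂ j)) ≡ F (2 + j)
enum₂-fib zero          = refl
enum₂-fib (suc zero)    = refl
enum₂-fib (suc (suc i)) = begin
  suc (length (enum₂ (2 + i)))                          ≡⟨ cong suc (length-enum₂-suc-suc i) ⟩
  suc (suc (length (enum₂ (1 + i)) + length (enum₂ i))) ≡⟨ cong suc (+-suc (length (enum₂ (1 + i))) _) ⟨
  suc (length (enum₂ (1 + i))) + suc (length (enum₂ i)) ≡⟨ cong₂ _+_ (enum₂-fib (suc i)) (enum₂-fib i) ⟩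
  F (3 + i) + F (2 + i)                                 ∎

peakedAll-fib : ∀ n → length (peakedAll n 0) + (n + 3) ≡ F (4 + n)
peakedAll-fib zero    = refl
peakedAll-fib (suc n) = begin
  length (peakedAll (suc n) 0) + (suc n + 3)
    ≡⟨ cong (_+ (suc n + 3)) (length-peakedAll-suc n 0) ⟩
  length (peakedAll n 0) + length (enum₂ (suc n)) + suc (n + 3)
    ≡⟨ shuffle (length (peakedAll n 0)) _ (n + 3) ⟩
  (length (peakedAll n 0) + (n + 3)) + suc (length (enum₂ (suc n)))
    ≡⟨ cong₂ _+_ (peakedAll-fib n) (enum₂-fib (suc n)) ⟩
  F (4 + n) + F (3 + n) ∎
  where
  shuffle : ∀ s b m → s + b + suc m ≡ (s + m) + suc b
  shuffle = ℕ-Solver.solve-∀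

enum₁-closed-form : ∀ n → length (enum₁ n) + (suc n C 2) + 2 * (suc n C 1) + 2 ≡ F (n + 5)
enum₁-closed-form n = trans (closed-form n) (cong F (+-comm 5 n))
  where
  closed-form : ∀ n → length (enum₁ n) + (suc n C 2) + 2 * (suc n C 1) + 2 ≡ F (5 + n)
  closed-form zero    = refl
  closed-form (suc n) = begin
    length (enum₁ (suc n)) + (2 + n) C 2 + 2 * ((2 + n) C 1) + 2
      ≡⟨ cong₂ (λ a x → a + x + 2 * ((2 + n) C 1) + 2) (length-enum₁-suc n) (sym pascal) ⟩
    A + S + (suc n + X) + 2 * ((2 + n) C 1) + 2
      ≡⟨ cong (λ y → A + S + (suc n + X) + 2 * y + 2) (nC1≡n (2 + n)) ⟩
    A + S + (suc n + X) + 2 * (2 + n) + 2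
      ≡⟨ regroup A S X n ⟩
    (A + X + 2 * suc n + 2) + (S + (n + 3))
      ≡⟨ cong₂ _+_ (trans (cong (λ y → A + X + 2 * y + 2) (sym (nC1≡n (suc n)))) (closed-form n))
                   (peakedAll-fib n) ⟩
    F (5 + n) + F (4 + n) ∎
    where
    A = length (enum₁ n)
    S = length (peakedAll n 0)
    X = suc n C 2
    pascal : suc n + X ≡ (2 + n) C 2
    pascal = trans (cong (_+ X) (sym (nC1≡n (suc n)))) (nCk+nC[k+1]≡[n+1]C[k+1] (suc n) 1)
    regroup : ∀ a s x n →
      a + s + (suc n + x) + 2 * (2 + n) + 2 ≡ (a + x + 2 * suc n + 2) + (s + (n + 3))
    regroup = ℕ-Solver.solve-∀

-- The generating function

Δ : (ℕ → ℤ) → ℕ → ℤ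
Δ = mulPS oneMinusX

-- `unfolded` is stated on the definitional unfolding of mulPS, which the ring solver cannot see through.
Δ-suc : ∀ A m → Δ A (suc m) ≡ A (suc m) - A m
Δ-suc A m = unfolded (A (suc m)) (A m)
  where
  unfolded : ∀ x y → + 1 ℤ.* x ℤ.+ (- + 1 ℤ.* y ℤ.+ + 0) ≡ x - y
  unfolded = ℤ-Solver.solve-∀

mulPS-fibDen-suc-suc : ∀ A m → mulPS fibDen A (2 + m) ≡ A (2 + m) - A (1 + m) - A m
mulPS-fibDen-suc-suc A m = unfolded (A (2 + m)) (A (1 + m)) (A m)
  where
  unfolded : ∀ x y z → + 1 ℤ.* x ℤ.+ (- + 1 ℤ.* y ℤ.+ (- + 1 ℤ.* z ℤ.+ + 0)) ≡ x - y - z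
  unfolded = ℤ-Solver.solve-∀

+[m+n]-+m : ∀ m n → + (m + n) - + m ≡ + n
+[m+n]-+m m n = trans (cong (_- + m) (ℤ.pos-+ m n)) (cancel (+ m) (+ n))
  where
  cancel : ∀ x y → x ℤ.+ y - x ≡ y
  cancel = ℤ-Solver.solve-∀

enum₁-series : ℕ → ℤ
enum₁-series n = + length (enum₁ n)

first-difference : ∀ n → Δ enum₁-series (suc n) ≡ + length (peakedAll n 0)
first-difference n = begin
  Δ enum₁-series (suc n)
    ≡⟨ Δ-suc enum₁-series n ⟩
  + length (enum₁ (suc n)) - + length (enum₁ n)
    ≡⟨ cong (λ k → + k - + length (enum₁ n)) (length-enum₁-suc n) ⟩
  + (length (enum₁ n) + length (peakedAll n 0)) - + length (enum₁ n)
    ≡⟨ +[m+n]-+m (length (enum₁ n)) _ ⟩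
  + length (peakedAll n 0) ∎

second-difference : ∀ n → Δ (Δ enum₁-series) (2 + n) ≡ + length (enum₂ (suc n))
second-difference n = begin
  Δ (Δ enum₁-series) (2 + n)
    ≡⟨ Δ-suc (Δ enum₁-series) (suc n) ⟩
  Δ enum₁-series (2 + n) - Δ enum₁-series (1 + n)
    ≡⟨ cong₂ _-_ (first-difference (suc n)) (first-difference n) ⟩
  + length (peakedAll (suc n) 0) - + length (peakedAll n 0)
    ≡⟨ cong (λ k → + k - + length (peakedAll n 0)) (length-peakedAll-suc n 0) ⟩
  + (length (peakedAll n 0) + length (enum₂ (suc n))) - + length (peakedAll n 0)
    ≡⟨ +[m+n]-+m (length (peakedAll n 0)) _ ⟩
  + length (enum₂ (suc n)) ∎

third-difference : ∀ n → Δ (Δ (Δ enum₁-series)) (3 + n)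
                         ≡ + length (enum₂ (2 + n)) - + length (enum₂ (1 + n))
third-difference n =
  trans (Δ-suc (Δ (Δ enum₁-series)) (2 + n)) (cong₂ _-_ (second-difference (suc n)) (second-difference n))

fibonacci-annihilates : ∀ x₁ x₂ x₃ x₄ → x₃ ≡ + 1 ℤ.+ (x₂ ℤ.+ x₁) → x₄ ≡ + 1 ℤ.+ (x₃ ℤ.+ x₂) →
  (x₄ - x₃) - (x₃ - x₂) - (x₂ - x₁) ≡ + 0
fibonacci-annihilates x₁ x₂ _ _ refl refl = vanish x₁ x₂
  where
  vanish : ∀ x₁ x₂ → let x₃ = + 1 ℤ.+ (x₂ ℤ.+ x₁) in
    (+ 1 ℤ.+ (x₃ ℤ.+ x₂) - x₃) - (x₃ - x₂) - (x₂ - x₁) ≡ + 0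
  vanish = ℤ-Solver.solve-∀

denomTimes-enum₁-series : ∀ n → denomTimes enum₁-series (5 + n) ≡ + 0
denomTimes-enum₁-series n = begin
  denomTimes enum₁-series (5 + n)
    ≡⟨ mulPS-fibDen-suc-suc D³ (3 + n) ⟩
  D³ (5 + n) - D³ (4 + n) - D³ (3 + n)
    ≡⟨ cong₂ _-_ (cong₂ _-_ (third-difference (2 + n)) (third-difference (1 + n))) (third-difference n) ⟩
  (b (4 + n) - b (3 + n)) - (b (3 + n) - b (2 + n)) - (b (2 + n) - b (1 + n))
    ≡⟨ fibonacci-annihilates (b (1 + n)) (b (2 + n)) _ _ (recurrence (1 + n)) (recurrence (2 + n)) ⟩
  + 0 ∎
  where
  D³ = Δ (Δ (Δ enum₁-series))
  b : ℕ → ℤ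
  b j = + length (enum₂ j)
  recurrence : ∀ i → b (2 + i) ≡ + 1 ℤ.+ (b (1 + i) ℤ.+ b i)
  recurrence i = trans (cong +_ (length-enum₂-suc-suc i))
                       (trans (ℤ.pos-+ 1 _) (cong (λ x → + 1 ℤ.+ x) (ℤ.pos-+ (length (enum₂ (1 + i))) _)))

generating-function : ∀ m → denomTimes enum₁-series m ≡ coeff numer m
generating-function 0 = refl
generating-function 1 = refl
generating-function 2 = refl
generating-function 3 = refl
generating-function 4 = refl
generating-function (suc (suc (suc (suc (suc n))))) = denomTimes-enum₁-series n

-- Permutations as vectors

StrictlyIncreasing : ∀ {k m} → (Fin k → Fin m) → Set
StrictlyIncreasing f = ∀ a b → a Fin.< b → f a Fin.< f b

toWord : ∀ {n m} → Vec (Fin n) m → Word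
toWord π = List.map toℕ (Vec.toList π)

length-toWord : ∀ {n m} (π : Vec (Fin n) m) → length (toWord π) ≡ m
length-toWord π = trans (length-map toℕ (Vec.toList π)) (length-toList π)

toWord-bounded : ∀ {n m} (π : Vec (Fin n) m) → All (_< n) (toWord π)
toWord-bounded π = All.tabulate λ x∈ → case ∈-map⁻ toℕ x∈ of λ { (i , _ , refl) → toℕ<n i }

⊆⇒embedding : ∀ {n m} (π : Vec (Fin n) m) {s} → s ⊆ toWord π → Σ (Fin (length s) → Fin m) λ g →
  StrictlyIncreasing g × (∀ a → List.lookup s a ≡ toℕ (Vec.lookup π (g a)))
⊆⇒embedding []      []         = (λ ()) , (λ ()) , (λ ())
⊆⇒embedding (x ∷ π) (_ ∷ʳ p) with g , g↑ , g≡ ← ⊆⇒embedding π p =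
  suc ∘ g , (λ a b a<b → s<s (g↑ a b a<b)) , g≡
⊆⇒embedding (x ∷ π) (refl ∷ p) with g , g↑ , g≡ ← ⊆⇒embedding π p =
  (λ { zero → zero ; (suc a) → suc (g a) }) ,
  (λ { zero (suc b) _ → z<s ; (suc a) (suc b) (s≤s a<b) → s<s (g↑ a b a<b) }) ,
  (λ { zero → refl ; (suc a) → g≡ a })

lower : ∀ {m} (i : Fin (suc m)) → 0 < toℕ i → Fin m
lower (suc i) _ = i

suc-lower : ∀ {m} (i : Fin (suc m)) (i>0 : 0 < toℕ i) → i ≡ suc (lower i i>0)
suc-lower (suc i) _ = refl

zero-or-pos : ∀ {m} (i : Fin (suc m)) → i ≡ zero ⊎ 0 < toℕ i
zero-or-pos zero    = inj₁ refl
zero-or-pos (suc i) = inj₂ z<s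

later-pos : ∀ {k m} (f : Fin (suc k) → Fin m) → StrictlyIncreasing f → ∀ a → 0 < toℕ (f (suc a))
later-pos f f↑ a = ≤-trans (s≤s z≤n) (f↑ zero (suc a) z<s)

lower-increasing : ∀ {k m} (f : Fin k → Fin (suc m)) (pos : ∀ a → 0 < toℕ (f a)) →
  StrictlyIncreasing f → StrictlyIncreasing (λ a → lower (f a) (pos a))
lower-increasing f pos f↑ a b a<b =
  ≤-pred (subst₂ Fin._<_ (suc-lower (f a) (pos a)) (suc-lower (f b) (pos b)) (f↑ a b a<b))

embedding⇒⊆ : ∀ {n m} (π : Vec (Fin n) m) k (f : Fin k → Fin m) → StrictlyIncreasing f →
  List.tabulate (λ a → toℕ (Vec.lookup π (f a))) ⊆ toWord π

lowered⇒⊆ : ∀ {n m} x (π : Vec (Fin n) m) k (f : Fin k → Fin (suc m)) (pos : ∀ a → 0 < toℕ (f a)) →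
  StrictlyIncreasing f → List.tabulate (λ a → toℕ (Vec.lookup (x ∷ π) (f a))) ⊆ toWord π
lowered⇒⊆ x π k f pos f↑ = subst (_⊆ toWord π) (tabulate-cong after-lowering)
  (embedding⇒⊆ π k (λ a → lower (f a) (pos a)) (lower-increasing f pos f↑))
  where
  after-lowering : ∀ a → toℕ (Vec.lookup π (lower (f a) (pos a))) ≡ toℕ (Vec.lookup (x ∷ π) (f a))
  after-lowering a = cong (toℕ ∘ Vec.lookup (x ∷ π)) (sym (suc-lower (f a) (pos a)))

embedding⇒⊆ []      zero    f f↑ = []
embedding⇒⊆ []      (suc k) f f↑ with () ← f zero
embedding⇒⊆ (x ∷ π) zero    f f↑ = minimum _
embedding⇒⊆ (x ∷ π) (suc k) f f↑ with zero-or-pos (f zero)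
... | inj₁ f0≡0 = cong (toℕ ∘ Vec.lookup (x ∷ π)) f0≡0 ∷
                  lowered⇒⊆ x π k (f ∘ suc) (later-pos f f↑) (λ a b a<b → f↑ (suc a) (suc b) (s<s a<b))
... | inj₂ f0>0 = _ ∷ʳ lowered⇒⊆ x π (suc k) f (λ { zero → f0>0 ; (suc a) → later-pos f f↑ a }) f↑

Realises : ∀ {k} → Vec ℕ k → (Fin k → ℕ) → Set
Realises σ u = ∀ a b → (Vec.lookup σ a < Vec.lookup σ b) ⇔ (u a < u b)

Realises-cong : ∀ {k} {σ : Vec ℕ k} {u v} → (∀ a → u a ≡ v a) → Realises σ u → Realises σ v
Realises-cong {σ = σ} u≗v r a b =
  subst₂ (λ x y → (Vec.lookup σ a < Vec.lookup σ b) ⇔ (x < y)) (u≗v a) (u≗v b) (r a b)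

contains⇒occurs₃ : ∀ {R} (σ : Vec ℕ 3) → (∀ {u} → Realises σ u → R (u (# 0)) (u (# 1)) (u (# 2))) →
  ∀ {n} (π : Vec (Fin n) n) → Contains π σ → Occurs (Pattern₃ R) (toWord π)
contains⇒occurs₃ σ extract π (f , f↑ , r) = _ , embedding⇒⊆ π 3 f f↑ , ⟨ extract r ⟩

contains⇒occurs₄ : ∀ {R} (σ : Vec ℕ 4) →
  (∀ {u} → Realises σ u → R (u (# 0)) (u (# 1)) (u (# 2)) (u (# 3))) →
  ∀ {n} (π : Vec (Fin n) n) → Contains π σ → Occurs (Pattern₄ R) (toWord π)
contains⇒occurs₄ σ extract π (f , f↑ , r) = _ , embedding⇒⊆ π 4 f f↑ , ⟨ extract r ⟩

occurs₃⇒contains : ∀ {R} (σ : Vec ℕ 3) →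
  (∀ {a b c} → R a b c → Realises σ (List.lookup (a ∷ b ∷ c ∷ []))) →
  ∀ {n} (π : Vec (Fin n) n) → Occurs (Pattern₃ R) (toWord π) → Contains π σ
occurs₃⇒contains σ realise π (_ , p , ⟨ r ⟩) with g , g↑ , g≡ ← ⊆⇒embedding π p =
  g , g↑ , Realises-cong {σ = σ} g≡ (realise r)

occurs₄⇒contains : ∀ {R} (σ : Vec ℕ 4) →
  (∀ {a b c d} → R a b c d → Realises σ (List.lookup (a ∷ b ∷ c ∷ d ∷ []))) →
  ∀ {n} (π : Vec (Fin n) n) → Occurs (Pattern₄ R) (toWord π) → Contains π σ
occurs₄⇒contains σ realise π (_ , p , ⟨ r ⟩) with g , g↑ , g≡ ← ⊆⇒embedding π p =
  g , g↑ , Realises-cong {σ = σ} g≡ (realise r)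

ascending : ∀ {x y u v} {x<y : True (x <? y)} → u < v → (x < y ⇔ u < v)
ascending {x<y = x<y} u<v = mk⇔ (λ _ → u<v) (λ _ → toWitness x<y)

descending : ∀ {x y u v} {y<x : True (y <? x)} → v < u → (x < y ⇔ u < v)
descending {y<x = y<x} v<u =
  mk⇔ (λ x<y → ⊥-elim (<-asym x<y (toWitness y<x))) (λ u<v → ⊥-elim (<-asym u<v v<u))

diagonal : ∀ {x u} → (x < x ⇔ u < u)
diagonal = mk⇔ (λ x<x → ⊥-elim (<-irrefl refl x<x)) (λ u<u → ⊥-elim (<-irrefl refl u<u))

forward : ∀ {x y u v} {x<y : True (x <? y)} → (x < y ⇔ u < v) → u < v
forward {x<y = x<y} iff = Equivalence.to iff (toWitness x<y)

realise-132 : ∀ {a b c} → a < c × c < b → Realises p132 (List.lookup (a ∷ b ∷ c ∷ []))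
realise-132 (a<c , c<b) = λ where
  zero             zero             → diagonal
  zero             (suc zero)       → ascending (<-trans a<c c<b)
  zero             (suc (suc zero)) → ascending a<c
  (suc zero)       zero             → descending (<-trans a<c c<b)
  (suc zero)       (suc zero)       → diagonal
  (suc zero)       (suc (suc zero)) → descending c<b
  (suc (suc zero)) zero             → descending a<c
  (suc (suc zero)) (suc zero)       → ascending c<b
  (suc (suc zero)) (suc (suc zero)) → diagonal

realise-2341 : ∀ {a b c d} → d < a × a < b × b < c →
  Realises p2341 (List.lookup (a ∷ b ∷ c ∷ d ∷ []))
realise-2341 (d<a , a<b , b<c) = λ where
  zero                   zero                   → diagonal
  zero                   (suc zero)             → ascending a<b
  zero                   (suc (suc zero))       → ascending (<-trans a<b b<c)
  zero                   (suc (suc (suc zero))) → descending d<a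
  (suc zero)             zero                   → descending a<b
  (suc zero)             (suc zero)             → diagonal
  (suc zero)             (suc (suc zero))       → ascending b<c
  (suc zero)             (suc (suc (suc zero))) → descending (<-trans d<a a<b)
  (suc (suc zero))       zero                   → descending (<-trans a<b b<c)
  (suc (suc zero))       (suc zero)             → descending b<c
  (suc (suc zero))       (suc (suc zero))       → diagonal
  (suc (suc zero))       (suc (suc (suc zero))) → descending (<-trans (<-trans d<a a<b) b<c)
  (suc (suc (suc zero))) zero                   → ascending d<a
  (suc (suc (suc zero))) (suc zero)             → ascending (<-trans d<a a<b)
  (suc (suc (suc zero))) (suc (suc zero))       → ascending (<-trans (<-trans d<a a<b) b<c)
  (suc (suc (suc zero))) (suc (suc (suc zero))) → diagonal

realise-4213 : ∀ {a b c d} → c < b × b < d × d < a →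
  Realises p4213 (List.lookup (a ∷ b ∷ c ∷ d ∷ []))
realise-4213 (c<b , b<d , d<a) = λ where
  zero                   zero                   → diagonal
  zero                   (suc zero)             → descending (<-trans b<d d<a)
  zero                   (suc (suc zero))       → descending (<-trans c<b (<-trans b<d d<a))
  zero                   (suc (suc (suc zero))) → descending d<a
  (suc zero)             zero                   → ascending (<-trans b<d d<a)
  (suc zero)             (suc zero)             → diagonal
  (suc zero)             (suc (suc zero))       → descending c<b
  (suc zero)             (suc (suc (suc zero))) → ascending b<d
  (suc (suc zero))       zero                   → ascending (<-trans c<b (<-trans b<d d<a))
  (suc (suc zero))       (suc zero)             → ascending c<b
  (suc (suc zero))       (suc (suc zero))       → diagonal
  (suc (suc zero))       (suc (suc (suc zero))) → ascending (<-trans c<b b<d)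
  (suc (suc (suc zero))) zero                   → ascending d<a
  (suc (suc (suc zero))) (suc zero)             → descending b<d
  (suc (suc (suc zero))) (suc (suc zero))       → descending (<-trans c<b b<d)
  (suc (suc (suc zero))) (suc (suc (suc zero))) → diagonal

extract-132 : ∀ {u} → Realises p132 u → u (# 0) < u (# 2) × u (# 2) < u (# 1)
extract-132 r = forward (r (# 0) (# 2)) , forward (r (# 2) (# 1))

extract-2341 : ∀ {u} → Realises p2341 u → u (# 3) < u (# 0) × u (# 0) < u (# 1) × u (# 1) < u (# 2)
extract-2341 r = forward (r (# 3) (# 0)) , forward (r (# 0) (# 1)) , forward (r (# 1) (# 2))

extract-4213 : ∀ {u} → Realises p4213 u → u (# 2) < u (# 1) × u (# 1) < u (# 3) × u (# 3) < u (# 0)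
extract-4213 r = forward (r (# 2) (# 1)) , forward (r (# 1) (# 3)) , forward (r (# 3) (# 0))

pair⊆ : ∀ {n m} (π : Vec (Fin n) m) {i j} → i Fin.< j →
  toℕ (Vec.lookup π i) ∷ toℕ (Vec.lookup π j) ∷ [] ⊆ toWord π
pair⊆ π {i} {j} i<j = embedding⇒⊆ π 2 (λ { zero → i ; (suc _) → j }) λ where
  zero       (suc zero) _         → i<j
  zero       zero       ()
  (suc zero) zero       ()
  (suc zero) (suc zero) (s≤s ())

IsPerm⇒Distinct : ∀ {n} (π : Vec (Fin n) n) → IsPerm π → Distinct (toWord π)
IsPerm⇒Distinct π injective x xx⊆ with g , g↑ , g≡ ← ⊆⇒embedding π xx⊆ =
  <-irrefl (cong toℕ (injective (g (# 0)) (g (# 1)) same-value)) (g↑ (# 0) (# 1) z<s)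
  where same-value = toℕ-injective (trans (sym (g≡ (# 0))) (g≡ (# 1)))

Distinct⇒IsPerm : ∀ {n} (π : Vec (Fin n) n) → Distinct (toWord π) → IsPerm π
Distinct⇒IsPerm π d i j π[i]≡π[j] with <-cmpᶠ i j
... | tri< i<j _ _ = ⊥-elim (d _ (subst (λ y → _ ∷ toℕ y ∷ [] ⊆ toWord π) (sym π[i]≡π[j]) (pair⊆ π i<j)))
... | tri≈ _ i≡j _ = i≡j
... | tri> _ _ j<i = ⊥-elim (d _ (subst (λ y → _ ∷ toℕ y ∷ [] ⊆ toWord π) π[i]≡π[j] (pair⊆ π j<i)))

InS⇔ : ∀ n (π : Vec (Fin n) n) → InS n π ⇔ (Perm n (toWord π) × Avoids₁ (toWord π))
InS⇔ n π = mk⇔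
  (λ (isPerm , ¬132 , ¬2341 , ¬4213) →
     perm (IsPerm⇒Distinct π isPerm) (toWord-bounded π) (length-toWord π) ,
     (λ o → ¬132  (occurs₃⇒contains p132  realise-132  π o)) ,
     (λ o → ¬2341 (occurs₄⇒contains p2341 realise-2341 π o)) ,
     (λ o → ¬4213 (occurs₄⇒contains p4213 realise-4213 π o)))
  (λ (p , ¬132 , ¬2341 , ¬4213) →
     Distinct⇒IsPerm π (distinct p) ,
     (λ c → ¬132  (contains⇒occurs₃ p132  extract-132  π c)) ,
     (λ c → ¬2341 (contains⇒occurs₄ p2341 extract-2341 π c)) ,
     (λ c → ¬4213 (contains⇒occurs₄ p4213 extract-4213 π c)))

-- fromWord truncates or pads (with 0) to length n and reduces the letters mod n; only its
-- values on permutation words matter.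
resize : ∀ k → Word → Vec ℕ k
resize zero    _       = []
resize (suc k) []      = 0 ∷ resize k []
resize (suc k) (x ∷ w) = x ∷ resize k w

fromWord : ∀ n → Word → Vec (Fin n) n
fromWord zero    _ = []
fromWord (suc n) w = Vec.map (_mod suc n) (resize (suc n) w)

toℕ-mod : ∀ {n x} → x < suc n → toℕ (x mod suc n) ≡ x
toℕ-mod {n} {x} x<1+n = trans (toℕ-fromℕ< _) (m≤n⇒m%n≡m (≤-pred x<1+n))

toWord-fromWord : ∀ {n w} → Perm n w → toWord (fromWord n w) ≡ w
toWord-fromWord {zero}  {[]}    _ = refl
toWord-fromWord {zero}  {_ ∷ _} p with () ← length≡ p
toWord-fromWord {suc n} {w}     p = go (suc n) w (length≡ p) (bounded p)
  where
  go : ∀ k w → length w ≡ k → All (_< suc n) w → toWord (Vec.map (_mod suc n) (resize k w)) ≡ w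
  go zero    []      _   _             = refl
  go (suc k) (x ∷ w) len (x<1+n ∷ bnd) = cong₂ _∷_ (toℕ-mod x<1+n) (go k w (suc-injective len) bnd)

fromWord-toWord : ∀ {n} (π : Vec (Fin n) n) → fromWord n (toWord π) ≡ π
fromWord-toWord {zero}  []  = refl
fromWord-toWord {suc n} π   = go π
  where
  go : ∀ {k} (v : Vec (Fin (suc n)) k) → Vec.map (_mod suc n) (resize k (toWord v)) ≡ v
  go []      = refl
  go (x ∷ v) = cong₂ _∷_ (toℕ-injective (toℕ-mod (toℕ<n x))) (go v)

fromWord-InS : ∀ {n w} → Perm n w → Avoids₁ w → InS n (fromWord n w)
fromWord-InS {n} {w} p av = Equivalence.from (InS⇔ n (fromWord n w))
  (subst (λ v → Perm n v × Avoids₁ v) (sym (toWord-fromWord p)) (p , av))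

enum₁-HasCard : ∀ n → HasCard n (InS n) (length (enum₁ n))
enum₁-HasCard n = permutations , unique , length-map (fromWord n) (enum₁ n) , membership
  where
  permutations = map (fromWord n) (enum₁ n)
  round-trip : map toWord permutations ≡ enum₁ n
  round-trip = trans (sym (map-∘ (enum₁ n)))
    (map-id-local (All.tabulate λ w∈ → toWord-fromWord (proj₁ (enum₁-sound n w∈))))
  unique : Unique permutations
  unique = Unique.map⁻ (subst Unique (sym round-trip) (enum₁-unique n))
  membership : ∀ π → (π ∈ permutations) ⇔ InS n π
  membership π = mk⇔
    (λ π∈ → case ∈-map⁻ (fromWord n) π∈ of λ where
       (w , w∈ , refl) → fromWord-InS (proj₁ (enum₁-sound n w∈)) (proj₂ (enum₁-sound n w∈)))
    (λ inS → case Equivalence.to (InS⇔ n π) inS of λ where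
       (p , av) → subst (_∈ permutations) (fromWord-toWord π)
                        (∈-map⁺ (fromWord n) (enum₁-complete n p av)))

-- The closed form holds for n = 0 as well.
mainTheorem14 : Σ (ℕ → ℕ) λ a →
    (∀ n → HasCard n (InS n) (a n))
    × (∀ n → n ≥ 1 → a n + ((suc n) C 2) + 2 * ((suc n) C 1) + 2 ≡ F (n + 5))
    × (∀ m → denomTimes (λ n → + (a n)) m ≡ coeff numer m)
mainTheorem14 =
  (λ n → length (enum₁ n)) , enum₁-HasCard , (λ n _ → enum₁-closed-form n) , generating-function
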